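{- Let $\mathcal{M}=(Q,r)$ be a sparse paving matroid of rank $k$. Let $X,Y\subseteq Q$ be a disjoint, nonmodular pair of flats of $\mathcal{M}$ such that $r(X)+r(Y)=k+1$ and $X$ is not a circuit-hyperplane. Then $\mathcal{M}$ admits an AK extension for $(X,Y)$.
   Context: Write $AB=A\cup B$ and $r(A|B)=r(AB)-r(B)$. A flat is a set $F$ with $r(Fx)>r(F)$ for all $x\notin F$; flats $X,Y$ are modular if $r(X)+r(Y)=r(XY)+r(X\cap Y)$, nonmodular otherwise. A matroid of rank $k$ is paving if every circuit has rank $k$ or $k-1$, and sparse paving if moreover every circuit of rank $k-1$ is a flat (such circuits are called circuit-hyperplanes). An extension of $(Q,r)$ is a polymatroid $(QZ,g)$ with $Q\cap Z=\emptyset$ and $g=r$ on subsets of $Q$. An AK extension for $(X,Y)$ is an extension $(QZ,g)$ with (AK1) $g(Z|X)=0$ and (AK2) $g(X'|Z)=g(X'|Y)$ for every $X'\subseteq X$. -}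

module Defs where

open import Data.Nat as ℕ using (ℕ; suc; _+_; _<_; _≤_)
open import Data.Integer using (+_)
open import Data.Rational as ℚ using (ℚ; _/_)
open import Data.Fin using (Fin)
open import Data.Fin.Subset using (Subset; _⊆_; _⊂_; _∪_; _∩_; ⁅_⁆; ∣_∣; _∉_; ⊥; ⊤)
open import Data.Vec using (_++_)
open import Data.Product using (_×_)
open import Data.Sum using (_⊎_)
open import Relation.Binary.PropositionalEquality using (_≡_; _≢_)

record IsMatroid (n : ℕ) (r : Subset n → ℕ) : Set where
  field
    rank-bounded : ∀ A → r A ≤ ∣ A ∣
    rank-mono    : ∀ A B → A ⊆ B → r A ≤ r B
    rank-submod  : ∀ A B → r (A ∪ B) + r (A ∩ B) ≤ r A + r B

module _ {n : ℕ} (r : Subset n → ℕ) where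

  Dependent : Subset n → Set
  Dependent C = r C < ∣ C ∣

  Circuit : Subset n → Set
  Circuit C = Dependent C × (∀ D → D ⊂ C → r D ≡ ∣ D ∣)

  Flat : Subset n → Set
  Flat F = ∀ x → x ∉ F → r F < r (F ∪ ⁅ x ⁆)

  Modular : Subset n → Subset n → Set
  Modular X Y = r X + r Y ≡ r (X ∪ Y) + r (X ∩ Y)

  Nonmodular : Subset n → Subset n → Set
  Nonmodular X Y = r X + r Y ≢ r (X ∪ Y) + r (X ∩ Y)

  IsPaving : ℕ → Set
  IsPaving k = ∀ C → Circuit C → (r C ≡ k) ⊎ (suc (r C) ≡ k)

  CircuitHyperplane : ℕ → Subset n → Set
  CircuitHyperplane k C = Circuit C × suc (r C) ≡ k × Flat C

  IsSparsePaving : ℕ → Set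
  IsSparsePaving k = IsMatroid n r × r ⊤ ≡ k × IsPaving k
                     × (∀ C → Circuit C → suc (r C) ≡ k → Flat C)

record IsPolymatroid (N : ℕ) (g : Subset N → ℚ) : Set where
  field
    normalized : g ⊥ ≡ ℚ.0ℚ
    mono       : ∀ A B → A ⊆ B → g A ℚ.≤ g B
    submod     : ∀ A B → g (A ∪ B) ℚ.+ g (A ∩ B) ℚ.≤ g A ℚ.+ g B

toℚ : ℕ → ℚ
toℚ a = (+ a) / 1

-- Q = Fin n is embedded as the first n points of Fin (n + m); Z is the last m.
liftQ : ∀ {n} m → Subset n → Subset (n + m)
liftQ m A = A ++ ⊥

Zset : ∀ n m → Subset (n + m)
Zset n m = ⊥ {n} ++ ⊤ {m}

IsExtension : ∀ {n} (r : Subset n → ℕ) m → (Subset (n + m) → ℚ) → Set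
IsExtension {n} r m g = IsPolymatroid (n + m) g × (∀ A → g (liftQ m A) ≡ toℚ (r A))

cond : ∀ {N} → (Subset N → ℚ) → Subset N → Subset N → ℚ
cond g A B = g (A ∪ B) ℚ.- g B

IsAKExtension : ∀ {n} (r : Subset n → ℕ) (X Y : Subset n) m → (Subset (n + m) → ℚ) → Set
IsAKExtension {n} r X Y m g =
  IsExtension r m g
  × cond g (Zset n m) (liftQ m X) ≡ ℚ.0ℚ
  × (∀ X′ → X′ ⊆ X → cond g (liftQ m X′) (Zset n m) ≡ cond g (liftQ m X′) (liftQ m Y))

{-# OPTIONS --safe #-}
-- In a sparse paving matroid of rank k, sets of fewer than k elements are
-- independent and sets of more than k elements span.  A flat of rank k would
-- contain Y, so r X < k; as X is not a circuit-hyperplane, |X| < k and X is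
-- independent, while |X ∪ Y| > k gives r (X ∪ Y) = k: the mutual information
-- r X + r Y − r (X ∪ Y) of X and Y is 1.  Subsets of X form modular pairs, so
-- the subsets of X not skew to Y are closed under intersection and have a least
-- member F.  Add one point z freely on the span of F (the principal extension,
-- g (A z) = min (r A + 1, r (A ∪ F))).  Then z lies in the span of X (AK1), and
-- for X′ ⊆ X adding z raises the rank of X′ exactly when F ⊄ X′, i.e. when X′
-- is skew to Y, which is AK2.
module Submission where

open import Defs
open import Data.Empty using (⊥-elim)
open import Data.Fin using (Fin; zero; suc)
open import Data.Fin.Subset
open import Data.Fin.Subset.Induction using (⊂-wellFounded)
open import Data.Fin.Subset.Properties
import Data.Integer as ℤ
import Data.Integer.Properties as ℤ
open import Data.Nat using (ℕ; zero; suc; _+_; _≤_; _<_; _⊓_; _≟_; _≤?_; _<?_; s≤s; z≤n)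
open import Data.Nat.Coprimality using (1-coprimeTo)
import Data.Nat.Coprimality as Coprimality
open import Data.Nat.Properties
open import Algebra.Properties.CommutativeSemigroup +-commutativeSemigroup
  using (x∙yz≈y∙xz; xy∙z≈xz∙y; interchange)
open import Data.Product using (_×_; _,_; proj₁; proj₂; ∃; ∃₂)
open import Data.Rational as ℚ using (ℚ; mkℚ; _/_)
import Data.Rational.Properties as ℚᵖ
open import Data.Rational.Solver using (module +-*-Solver)
open import Data.Sum using (_⊎_; inj₁; inj₂; [_,_]′)
open import Data.Vec using (Vec; []; _∷_; _++_; take; drop; here; there)
open import Data.Vec.Properties using (take-zipWith; drop-zipWith; take++drop≡id; zipWith-++)
open import Function using (_∘′_)
open import Induction.WellFounded using (Acc; acc)
open import Level using (Level)
open import Relation.Binary.Definitions using (tri<; tri≈; tri>)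
open import Relation.Binary.PropositionalEquality
open import Relation.Nullary using (¬_; Dec; yes; no; contradiction)
open import Relation.Nullary.Decidable using (_×-dec_)
open import Relation.Unary using (Pred; Decidable)

private
  variable
    ℓ : Level
    m n : ℕ
    T : Set ℓ
    p q s : Subset n

∣p∪q∣+∣p∩q∣≡∣p∣+∣q∣ : ∀ (p q : Subset n) → ∣ p ∪ q ∣ + ∣ p ∩ q ∣ ≡ ∣ p ∣ + ∣ q ∣
∣p∪q∣+∣p∩q∣≡∣p∣+∣q∣ []            []            = refl
∣p∪q∣+∣p∩q∣≡∣p∣+∣q∣ (inside  ∷ p) (inside  ∷ q) = cong suc (begin
  ∣ p ∪ q ∣ + suc ∣ p ∩ q ∣  ≡⟨ +-suc _ _ ⟩
  suc (∣ p ∪ q ∣ + ∣ p ∩ q ∣) ≡⟨ cong suc (∣p∪q∣+∣p∩q∣≡∣p∣+∣q∣ p q) ⟩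
  suc (∣ p ∣ + ∣ q ∣)         ≡⟨ +-suc _ _ ⟨
  ∣ p ∣ + suc ∣ q ∣           ∎)
  where open ≡-Reasoning
∣p∪q∣+∣p∩q∣≡∣p∣+∣q∣ (inside  ∷ p) (outside ∷ q) = cong suc (∣p∪q∣+∣p∩q∣≡∣p∣+∣q∣ p q)
∣p∪q∣+∣p∩q∣≡∣p∣+∣q∣ (outside ∷ p) (inside  ∷ q) =
  trans (cong suc (∣p∪q∣+∣p∩q∣≡∣p∣+∣q∣ p q)) (sym (+-suc _ _))
∣p∪q∣+∣p∩q∣≡∣p∣+∣q∣ (outside ∷ p) (outside ∷ q) = ∣p∪q∣+∣p∩q∣≡∣p∣+∣q∣ p q

∣p++q∣≡∣p∣+∣q∣ : ∀ (p : Subset m) (q : Subset n) → ∣ p ++ q ∣ ≡ ∣ p ∣ + ∣ q ∣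
∣p++q∣≡∣p∣+∣q∣ []            q = refl
∣p++q∣≡∣p∣+∣q∣ (inside  ∷ p) q = cong suc (∣p++q∣≡∣p∣+∣q∣ p q)
∣p++q∣≡∣p∣+∣q∣ (outside ∷ p) q = ∣p++q∣≡∣p∣+∣q∣ p q

0<∣p∣⇒Nonempty : 0 < ∣ p ∣ → Nonempty p
0<∣p∣⇒Nonempty {p = inside  ∷ p} _      = zero , here
0<∣p∣⇒Nonempty {p = outside ∷ p} 0<∣p∣ with 0<∣p∣⇒Nonempty 0<∣p∣
... | x , x∈p = suc x , there x∈p

x∈p⇒∣p∣≡1+∣p-x∣ : ∀ {x : Fin n} → x ∈ p → ∣ p ∣ ≡ suc ∣ p - x ∣
x∈p⇒∣p∣≡1+∣p-x∣ {p = inside  ∷ p} here        = cong (suc ∘′ ∣_∣) (sym (p─⊥≡p p))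
x∈p⇒∣p∣≡1+∣p-x∣ {p = inside  ∷ p} (there x∈p) = cong suc (x∈p⇒∣p∣≡1+∣p-x∣ x∈p)
x∈p⇒∣p∣≡1+∣p-x∣ {p = outside ∷ p} (there x∈p) = x∈p⇒∣p∣≡1+∣p-x∣ x∈p

x∉p-x : ∀ (p : Subset n) x → x ∉ p - x
x∉p-x (_ ∷ p) zero    ()
x∉p-x (_ ∷ p) (suc x) (there x∈p-x) = x∉p-x p x x∈p-x

∪-lub : p ⊆ s → q ⊆ s → p ∪ q ⊆ s
∪-lub {p = p} {q = q} p⊆s q⊆s x∈p∪q with x∈p∪q⁻ p q x∈p∪q
... | inj₁ x∈p = p⊆s x∈p
... | inj₂ x∈q = q⊆s x∈q

∩-glb : s ⊆ p → s ⊆ q → s ⊆ p ∩ q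
∩-glb s⊆p s⊆q x∈s = x∈p∩q⁺ (s⊆p x∈s , s⊆q x∈s)

∪-mono-⊆ : ∀ {p′ q′ : Subset n} → p ⊆ p′ → q ⊆ q′ → p ∪ q ⊆ p′ ∪ q′
∪-mono-⊆ p⊆p′ q⊆q′ = ∪-lub (⊆-trans p⊆p′ (p⊆p∪q _)) (⊆-trans q⊆q′ (q⊆p∪q _ _))

∩-mono-⊆ : ∀ {p′ q′ : Subset n} → p ⊆ p′ → q ⊆ q′ → p ∩ q ⊆ p′ ∩ q′
∩-mono-⊆ {p = p} {q} p⊆p′ q⊆q′ = ∩-glb (⊆-trans (p∩q⊆p p q) p⊆p′) (⊆-trans (p∩q⊆q p q) q⊆q′)

x∈p⇒p-x∪⁅x⁆⊆p : ∀ {x : Fin n} → x ∈ p → (p - x) ∪ ⁅ x ⁆ ⊆ p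
x∈p⇒p-x∪⁅x⁆⊆p {p = p} {x = x} x∈p =
  ∪-lub (p─q⊆p p ⁅ x ⁆) (λ y∈⁅x⁆ → subst (_∈ p) (sym (x∈⁅y⁆⇒x≡y x y∈⁅x⁆)) x∈p)

p⊆q∧p⊄q⇒q⊆p : p ⊆ q → p ⊄ q → q ⊆ p
p⊆q∧p⊄q⇒q⊆p {p = p} p⊆q p⊄q {x} x∈q with x ∈? p
... | yes x∈p = x∈p
... | no  x∉p = ⊥-elim (p⊄q (p⊆q , x , x∈q , x∉p))

⊂-minimal : {P : Pred (Subset n) ℓ} → Decidable P → P p →
            ∃ λ q → P q × (∀ {s} → s ⊂ q → ¬ P s)
⊂-minimal {P = P} P? = go (⊂-wellFounded _)
  where
  go : Acc _⊂_ p → P p → ∃ λ q → P q × (∀ {s} → s ⊂ q → ¬ P s)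
  go {p} (acc rec) Pp with anySubset? (λ s → s ⊂? p ×-dec P? s)
  ... | yes (s , s⊂p , Ps) = go (rec s⊂p) Ps
  ... | no  ∄s             = p , Pp , λ s⊂p Ps → ∄s (_ , s⊂p , Ps)

take-⊆ : ∀ m {p q : Subset (m + n)} → p ⊆ q → take m p ⊆ take m q
take-⊆ zero    p⊆q ()
take-⊆ (suc m) {inside ∷ p} {_ ∷ q} p⊆q here with p⊆q here
... | here = here
take-⊆ (suc m) {_ ∷ p} {_ ∷ q} p⊆q (there x∈p) = there (take-⊆ m (drop-∷-⊆ p⊆q) x∈p)

drop-⊆ : ∀ m {p q : Subset (m + n)} → p ⊆ q → drop m p ⊆ drop m q
drop-⊆ zero    p⊆q = p⊆q
drop-⊆ (suc m) {_ ∷ p} {_ ∷ q} p⊆q = drop-⊆ m (drop-∷-⊆ p⊆q)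

take-++ : ∀ (xs : Vec T m) (ys : Vec T n) → take m (xs ++ ys) ≡ xs
take-++ []       ys = refl
take-++ (x ∷ xs) ys = cong (x ∷_) (take-++ xs ys)

drop-++ : ∀ (xs : Vec T m) (ys : Vec T n) → drop m (xs ++ ys) ≡ ys
drop-++ []       ys = refl
drop-++ (x ∷ xs) ys = drop-++ xs ys

toℚ≡mkℚ : ∀ m → toℚ m ≡ mkℚ (ℤ.+ m) 0 (Coprimality.sym (1-coprimeTo m))
toℚ≡mkℚ m = ℚᵖ.normalize-coprime (Coprimality.sym (1-coprimeTo m))

toℚ-mono-≤ : m ≤ n → toℚ m ℚ.≤ toℚ n
toℚ-mono-≤ {m} {n} m≤n rewrite toℚ≡mkℚ m | toℚ≡mkℚ n =
  ℚ.*≤* (subst₂ ℤ._≤_ (sym (ℤ.*-identityʳ (ℤ.+ m))) (sym (ℤ.*-identityʳ (ℤ.+ n))) (ℤ.+≤+ m≤n))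

toℚ-homo-+ : ∀ m n → toℚ (m + n) ≡ toℚ m ℚ.+ toℚ n
toℚ-homo-+ m n rewrite toℚ≡mkℚ m | toℚ≡mkℚ n =
  cong (_/ 1) (sym (cong₂ ℤ._+_ (ℤ.*-identityʳ (ℤ.+ m)) (ℤ.*-identityʳ (ℤ.+ n))))

cross-sum⇒toℚ-diff≡ : ∀ a b c d → a + d ≡ c + b → toℚ a ℚ.- toℚ b ≡ toℚ c ℚ.- toℚ d
cross-sum⇒toℚ-diff≡ a b c d a+d≡c+b = begin
  x ℚ.- y                 ≡⟨ +-*-Solver.solve 3 (λ x y w → x :- y := (x :+ w) :- (y :+ w)) refl x y w ⟩
  (x ℚ.+ w) ℚ.- (y ℚ.+ w) ≡⟨ cong (ℚ._- (y ℚ.+ w)) x+w≡z+y ⟩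
  (z ℚ.+ y) ℚ.- (y ℚ.+ w) ≡⟨ +-*-Solver.solve 3 (λ z y w → (z :+ y) :- (y :+ w) := z :- w) refl z y w ⟩
  z ℚ.- w                 ∎
  where
  open ≡-Reasoning
  open +-*-Solver hiding (solve)
  x = toℚ a
  y = toℚ b
  z = toℚ c
  w = toℚ d
  x+w≡z+y : x ℚ.+ w ≡ z ℚ.+ y
  x+w≡z+y = trans (sym (toℚ-homo-+ a d)) (trans (cong toℚ a+d≡c+b) (toℚ-homo-+ c b))

module MatroidProperties {n} {r : Subset n → ℕ} (M : IsMatroid n r) where
  open IsMatroid M

  private
    variable
      A B C D : Subset n

  rank-⊥ : r ⊥ ≡ 0
  rank-⊥ = n≤0⇒n≡0 (≤-trans (rank-bounded ⊥) (≤-reflexive (∣⊥∣≡0 n)))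

  submod-⊆ : C ⊆ A ∪ B → D ⊆ A ∩ B → r C + r D ≤ r A + r B
  submod-⊆ {A = A} {B} C⊆A∪B D⊆A∩B =
    ≤-trans (+-mono-≤ (rank-mono _ _ C⊆A∪B) (rank-mono _ _ D⊆A∩B)) (rank-submod A B)

  submod-∪ : ∀ A B S → r ((A ∪ B) ∪ S) + r ((A ∩ B) ∪ S) ≤ r (A ∪ S) + r (B ∪ S)
  submod-∪ A B S = submod-⊆
    (∪-lub (∪-mono-⊆ (p⊆p∪q S) (p⊆p∪q S)) (⊆-trans (q⊆p∪q A S) (p⊆p∪q _)))
    (⊆-reflexive (∪-distribʳ-∩ S A B))

  submod-∪ˡ : ∀ A B S → r ((A ∪ B) ∪ S) + r (A ∩ B) ≤ r (A ∪ S) + r B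
  submod-∪ˡ A B S = submod-⊆
    (∪-lub (∪-mono-⊆ (p⊆p∪q S) ⊆-refl) (⊆-trans (q⊆p∪q A S) (p⊆p∪q B)))
    (∩-mono-⊆ (p⊆p∪q S) ⊆-refl)

  submod-∪ʳ : ∀ A B S → r ((A ∪ B) ∪ S) + r (A ∩ B) ≤ r A + r (B ∪ S)
  submod-∪ʳ A B S = submod-⊆ (⊆-reflexive (∪-assoc A B S)) (∩-mono-⊆ ⊆-refl (p⊆p∪q S))

  rank-subadditive : ∀ A B → r (A ∪ B) ≤ r A + r B
  rank-subadditive A B = ≤-trans (m≤m+n _ _) (rank-submod A B)

  flat∧full-rank⇒⊤⊆ : Flat r A → r ⊤ ≤ r A → ⊤ ⊆ A
  flat∧full-rank⇒⊤⊆ {A} flat r⊤≤rA {x} _ with x ∈? A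
  ... | yes x∈A = x∈A
  ... | no  x∉A = contradiction (≤-trans (rank-mono _ _ ⊆⊤) r⊤≤rA) (<⇒≱ (flat x x∉A))

  module _ (Y : Subset n) where

    Nonskew : Subset n → Set
    Nonskew A = r (A ∪ Y) < r A + r Y

    nonskew? : Decidable Nonskew
    nonskew? A = r (A ∪ Y) <? r A + r Y

    -- Monotonicity of the mutual information r A + r Y − r (A ∪ Y) in A,
    -- written without subtraction.
    mutual-mono : A ⊆ B → r A + r (B ∪ Y) ≤ r B + r (A ∪ Y)
    mutual-mono {A} {B} A⊆B = subst (_≤ r B + r (A ∪ Y)) (+-comm (r (B ∪ Y)) (r A))
      (submod-⊆ (∪-mono-⊆ ⊆-refl (q⊆p∪q A Y)) (∩-glb A⊆B (p⊆p∪q Y)))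

    nonskew-mono : A ⊆ B → Nonskew A → Nonskew B
    nonskew-mono {A} {B} A⊆B A-nonskew = +-cancelˡ-≤ (r A) _ _ (begin
      r A + suc (r (B ∪ Y)) ≡⟨ +-suc (r A) _ ⟩
      suc (r A + r (B ∪ Y)) ≤⟨ s≤s (mutual-mono A⊆B) ⟩
      suc (r B + r (A ∪ Y)) ≡⟨ +-suc (r B) _ ⟨
      r B + suc (r (A ∪ Y)) ≤⟨ +-monoʳ-≤ (r B) A-nonskew ⟩
      r B + (r A + r Y)     ≡⟨ x∙yz≈y∙xz (r B) (r A) (r Y) ⟩
      r A + (r B + r Y)     ∎)
      where open ≤-Reasoning

    nonskew⇒rank-pos : Nonskew A → 0 < r A
    nonskew⇒rank-pos {A} A-nonskew =
      +-cancelʳ-≤ (r Y) 1 (r A) (≤-trans (s≤s (rank-mono _ _ (q⊆p∪q A Y))) A-nonskew)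

    -- Along a modular pair the mutual information is supermodular, so if it is
    -- at most 1 on the union it is positive on the intersection.
    nonskew-∩ : r A + r B ≡ r (A ∪ B) + r (A ∩ B) → r (A ∪ B) + r Y ≤ suc (r ((A ∪ B) ∪ Y)) →
                Nonskew A → Nonskew B → Nonskew (A ∩ B)
    nonskew-∩ {A} {B} modular mutual≤1 A-nonskew B-nonskew = +-cancelˡ-≤ (suc u) _ _ (begin
      suc u + suc i                         ≡⟨ cong suc (+-suc u i) ⟩
      suc (suc (u + i))                     ≤⟨ s≤s (s≤s union-intersection) ⟩
      suc (suc (a + b))                     ≡⟨ cong suc (+-suc a b) ⟨
      suc a + suc b                         ≤⟨ +-mono-≤ A-nonskew B-nonskew ⟩
      (r A + r Y) + (r B + r Y)             ≡⟨ interchange (r A) (r Y) (r B) (r Y) ⟩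
      (r A + r B) + (r Y + r Y)             ≡⟨ cong (_+ (r Y + r Y)) modular ⟩
      (r (A ∪ B) + r (A ∩ B)) + (r Y + r Y) ≡⟨ interchange (r (A ∪ B)) (r (A ∩ B)) (r Y) (r Y) ⟩
      (r (A ∪ B) + r Y) + (r (A ∩ B) + r Y) ≤⟨ +-monoˡ-≤ _ mutual≤1 ⟩
      suc u + (r (A ∩ B) + r Y)             ∎)
      where
      open ≤-Reasoning
      u = r ((A ∪ B) ∪ Y)
      i = r ((A ∩ B) ∪ Y)
      a = r (A ∪ Y)
      b = r (B ∪ Y)
      union-intersection : u + i ≤ a + b
      union-intersection = submod-∪ A B Y

matroid⇒polymatroid : ∀ {N} {h : Subset N → ℕ} → IsMatroid N h → IsPolymatroid N (λ U → toℚ (h U))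
matroid⇒polymatroid {h = h} M = record
  { normalized = cong toℚ rank-⊥
  ; mono       = λ U V U⊆V → toℚ-mono-≤ (rank-mono U V U⊆V)
  ; submod     = λ U V → subst₂ ℚ._≤_ (toℚ-homo-+ (h (U ∪ V)) (h (U ∩ V))) (toℚ-homo-+ (h U) (h V))
                                      (toℚ-mono-≤ (rank-submod U V))
  }
  where
  open IsMatroid M
  open MatroidProperties M

-- The principal extension of r by a point z placed freely on the flat spanned
-- by F; a subset of the extended ground set is split as A ++ z with z : Subset 1.
module PrincipalExtension {n} {r : Subset n → ℕ} (M : IsMatroid n r) (F : Subset n) where
  open IsMatroid M
  open MatroidProperties M

  private
    variable
      A B : Subset n
      a b : Subset 1

  rank⁺ : Subset n → Subset 1 → ℕ
  rank⁺ A (outside ∷ []) = r A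
  rank⁺ A (inside  ∷ []) = suc (r A) ⊓ r (A ∪ F)

  rank⁺-bounded : ∀ A z → rank⁺ A z ≤ ∣ A ∣ + ∣ z ∣
  rank⁺-bounded A (outside ∷ []) = ≤-trans (rank-bounded A) (m≤m+n _ 0)
  rank⁺-bounded A (inside  ∷ []) =
    ≤-trans (m⊓n≤m _ _) (subst (suc (r A) ≤_) (+-comm 1 ∣ A ∣) (s≤s (rank-bounded A)))

  rank⁺-mono : A ⊆ B → a ⊆ b → rank⁺ A a ≤ rank⁺ B b
  rank⁺-mono {a = outside ∷ []} {outside ∷ []} A⊆B _ = rank-mono _ _ A⊆B
  rank⁺-mono {a = outside ∷ []} {inside  ∷ []} A⊆B _ =
    ⊓-glb (m≤n⇒m≤1+n (rank-mono _ _ A⊆B)) (rank-mono _ _ (⊆-trans A⊆B (p⊆p∪q F)))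
  rank⁺-mono {a = inside  ∷ []} {inside  ∷ []} A⊆B _ =
    ⊓-mono-≤ (s≤s (rank-mono _ _ A⊆B)) (rank-mono _ _ (∪-mono-⊆ A⊆B ⊆-refl))
  rank⁺-mono {a = inside  ∷ []} {outside ∷ []} _ a⊆b = contradiction (a⊆b here) λ ()

  rank⁺-⊤≤free : ∀ A → rank⁺ A ⊤ ≤ suc (r A)
  rank⁺-⊤≤free A = m⊓n≤m _ _

  rank⁺-⊤≤spanned : ∀ A → rank⁺ A ⊤ ≤ r (A ∪ F)
  rank⁺-⊤≤spanned A = m⊓n≤n _ _

  -- In each case, bound the left-hand side through whichever term attains
  -- the minimum on the right.
  rank⁺-submod : ∀ A B a b → rank⁺ (A ∪ B) (a ∪ b) + rank⁺ (A ∩ B) (a ∩ b) ≤ rank⁺ A a + rank⁺ B b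
  rank⁺-submod A B (outside ∷ []) (outside ∷ []) = rank-submod A B
  rank⁺-submod A B (inside  ∷ []) (outside ∷ []) with ⊓-sel (suc (r A)) (r (A ∪ F))
  ... | inj₁ eq rewrite eq = ≤-trans (+-monoˡ-≤ _ (rank⁺-⊤≤free (A ∪ B))) (s≤s (rank-submod A B))
  ... | inj₂ eq rewrite eq = ≤-trans (+-monoˡ-≤ _ (rank⁺-⊤≤spanned (A ∪ B))) (submod-∪ˡ A B F)
  rank⁺-submod A B (outside ∷ []) (inside  ∷ []) =
    subst₂ (λ U I → rank⁺ U ⊤ + r I ≤ r A + rank⁺ B ⊤) (∪-comm B A) (∩-comm B A)
      (subst (rank⁺ (B ∪ A) ⊤ + r (B ∩ A) ≤_) (+-comm (rank⁺ B ⊤) (r A))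
             (rank⁺-submod B A (inside ∷ []) (outside ∷ [])))
  rank⁺-submod A B (inside  ∷ []) (inside  ∷ [])
    with ⊓-sel (suc (r A)) (r (A ∪ F)) | ⊓-sel (suc (r B)) (r (B ∪ F))
  ... | inj₁ eqA | inj₁ eqB rewrite eqA | eqB =
    ≤-trans (+-mono-≤ (rank⁺-⊤≤free (A ∪ B)) (rank⁺-⊤≤free (A ∩ B)))
            (s≤s (subst₂ _≤_ (sym (+-suc (r (A ∪ B)) (r (A ∩ B)))) (sym (+-suc (r A) (r B)))
                             (s≤s (rank-submod A B))))
  ... | inj₂ eqA | inj₂ eqB rewrite eqA | eqB =
    ≤-trans (+-mono-≤ (rank⁺-⊤≤spanned (A ∪ B)) (rank⁺-⊤≤spanned (A ∩ B))) (submod-∪ A B F)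
  ... | inj₁ eqA | inj₂ eqB rewrite eqA | eqB =
    ≤-trans (+-mono-≤ (rank⁺-⊤≤spanned (A ∪ B)) (rank⁺-⊤≤free (A ∩ B)))
            (subst (_≤ suc (r A) + r (B ∪ F)) (sym (+-suc (r ((A ∪ B) ∪ F)) (r (A ∩ B))))
                   (s≤s (submod-∪ʳ A B F)))
  ... | inj₂ eqA | inj₁ eqB rewrite eqA | eqB =
    ≤-trans (+-mono-≤ (rank⁺-⊤≤spanned (A ∪ B)) (rank⁺-⊤≤free (A ∩ B)))
            (subst₂ _≤_ (sym (+-suc (r ((A ∪ B) ∪ F)) (r (A ∩ B)))) (sym (+-suc (r (A ∪ F)) (r B)))
                    (s≤s (submod-∪ˡ A B F)))

  rank⁺-⊤-spanned : F ⊆ A → rank⁺ A ⊤ ≡ r A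
  rank⁺-⊤-spanned {A} F⊆A = trans (m≥n⇒m⊓n≡n (≤-trans (≤-reflexive r[A∪F]≡rA) (n≤1+n _))) r[A∪F]≡rA
    where
    r[A∪F]≡rA : r (A ∪ F) ≡ r A
    r[A∪F]≡rA = ≤-antisym (rank-mono _ _ (∪-lub ⊆-refl F⊆A)) (rank-mono _ _ (p⊆p∪q F))

  rank⁺-⊤-free : r A < r (A ∪ F) → rank⁺ A ⊤ ≡ suc (r A)
  rank⁺-⊤-free = m≤n⇒m⊓n≡m

  rank⁺-⊥-⊤ : 0 < r F → rank⁺ ⊥ ⊤ ≡ 1
  rank⁺-⊥-⊤ 0<rF = begin
    suc (r ⊥) ⊓ r (⊥ ∪ F) ≡⟨ cong₂ (λ k B → suc k ⊓ r B) rank-⊥ (∪-identityˡ F) ⟩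
    1 ⊓ r F               ≡⟨ m≤n⇒m⊓n≡m 0<rF ⟩
    1                     ∎
    where open ≡-Reasoning

  rank : Subset (n + 1) → ℕ
  rank U = rank⁺ (take n U) (drop n U)

  rank-++ : ∀ A z → rank (A ++ z) ≡ rank⁺ A z
  rank-++ A z = cong₂ rank⁺ (take-++ A z) (drop-++ A z)

  rank-++-∪ : ∀ A B a b → rank ((A ++ a) ∪ (B ++ b)) ≡ rank⁺ (A ∪ B) (a ∪ b)
  rank-++-∪ A B a b = trans (cong rank (zipWith-++ _ A a B b)) (rank-++ (A ∪ B) (a ∪ b))

  isMatroid : IsMatroid (n + 1) rank
  isMatroid = record
    { rank-bounded = λ U → subst (rank U ≤_) (∣take∣+∣drop∣ U) (rank⁺-bounded (take n U) (drop n U))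
    ; rank-mono    = λ U V U⊆V → rank⁺-mono (take-⊆ n U⊆V) (drop-⊆ n U⊆V)
    ; rank-submod  = λ U V → subst₂ (λ P Q → P + Q ≤ rank U + rank V)
        (sym (cong₂ rank⁺ (take-zipWith _ U V) (drop-zipWith _ U V)))
        (sym (cong₂ rank⁺ (take-zipWith _ U V) (drop-zipWith _ U V)))
        (rank⁺-submod (take n U) (take n V) (drop n U) (drop n V))
    }
    where
    ∣take∣+∣drop∣ : ∀ U → ∣ take n U ∣ + ∣ drop n U ∣ ≡ ∣ U ∣
    ∣take∣+∣drop∣ U =
      trans (sym (∣p++q∣≡∣p∣+∣q∣ (take n U) (drop n U))) (cong ∣_∣ (take++drop≡id n U))

module Paving {n k} {r : Subset n → ℕ} (M : IsMatroid n r) (paving : IsPaving r k) where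
  open IsMatroid M

  circuit⇒k≤∣C∣ : ∀ {C} → Circuit r C → k ≤ ∣ C ∣
  circuit⇒k≤∣C∣ {C} circuit@(dependent , _) with paving C circuit
  ... | inj₁ rC≡k   = ≤-trans (≤-reflexive (sym rC≡k)) (<⇒≤ dependent)
  ... | inj₂ 1+rC≡k = subst (_≤ ∣ C ∣) 1+rC≡k dependent

  ∣A∣<k⇒independent : ∀ {A} → ∣ A ∣ < k → r A ≡ ∣ A ∣
  ∣A∣<k⇒independent = go (⊂-wellFounded _)
    where
    go : ∀ {A} → Acc _⊂_ A → ∣ A ∣ < k → r A ≡ ∣ A ∣
    go {A} (acc rec) ∣A∣<k with r A ≟ ∣ A ∣
    ... | yes rA≡∣A∣ = rA≡∣A∣
    ... | no  rA≢∣A∣ = contradiction (circuit⇒k≤∣C∣ (dependent , subsets-independent)) (<⇒≱ ∣A∣<k)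
      where
      dependent : r A < ∣ A ∣
      dependent = ≤∧≢⇒< (rank-bounded A) rA≢∣A∣
      subsets-independent : ∀ D → D ⊂ A → r D ≡ ∣ D ∣
      subsets-independent D D⊂A = go (rec D⊂A) (<-trans (p⊂q⇒∣p∣<∣q∣ D⊂A) ∣A∣<k)

module SparsePaving {n k} {r : Subset n → ℕ} (sparse-paving : IsSparsePaving r k) where
  M : IsMatroid n r
  M = proj₁ sparse-paving

  private
    r⊤≡k : r ⊤ ≡ k
    r⊤≡k = proj₁ (proj₂ sparse-paving)

    paving : IsPaving r k
    paving = proj₁ (proj₂ (proj₂ sparse-paving))

    circuitHyperplane-flat : ∀ C → Circuit r C → suc (r C) ≡ k → Flat r C
    circuitHyperplane-flat = proj₂ (proj₂ (proj₂ sparse-paving))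

  open IsMatroid M
  open Paving M paving public

  r≤k : ∀ A → r A ≤ k
  r≤k A = ≤-trans (rank-mono _ _ ⊆⊤) (≤-reflexive r⊤≡k)

  ∣A∣≡k⇒spanning⊎circuitHyperplane : ∀ {A} → ∣ A ∣ ≡ k → k ≤ r A ⊎ CircuitHyperplane r k A
  ∣A∣≡k⇒spanning⊎circuitHyperplane {A} ∣A∣≡k with k ≤? r A
  ... | yes k≤rA = inj₁ k≤rA
  ... | no  k≰rA = inj₂ (circuit , 1+rA≡k , circuitHyperplane-flat A circuit 1+rA≡k)
    where
    circuit : Circuit r A
    circuit = subst (r A <_) (sym ∣A∣≡k) (≰⇒> k≰rA)
            , λ D D⊂A → ∣A∣<k⇒independent (subst (∣ D ∣ <_) ∣A∣≡k (p⊂q⇒∣p∣<∣q∣ D⊂A))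
    1+rA≡k : suc (r A) ≡ k
    1+rA≡k with paving A circuit
    ... | inj₁ rA≡k   = contradiction (≤-reflexive (sym rA≡k)) k≰rA
    ... | inj₂ 1+rA≡k = 1+rA≡k

  spanning⊎circuitHyperplane⇒spanning-∪⁅x⁆ : ∀ {A x} → k ≤ r A ⊎ CircuitHyperplane r k A → x ∉ A →
                                             k ≤ r (A ∪ ⁅ x ⁆)
  spanning⊎circuitHyperplane⇒spanning-∪⁅x⁆ (inj₁ k≤rA) _ = ≤-trans k≤rA (rank-mono _ _ (p⊆p∪q _))
  spanning⊎circuitHyperplane⇒spanning-∪⁅x⁆ (inj₂ (_ , 1+rA≡k , flat)) x∉A =
    subst (_≤ _) 1+rA≡k (flat _ x∉A)

  k<∣A∣⇒spanning : ∀ {A} → k < ∣ A ∣ → k ≤ r A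
  k<∣A∣⇒spanning = go (⊂-wellFounded _)
    where
    go : ∀ {A} → Acc _⊂_ A → k < ∣ A ∣ → k ≤ r A
    go {A} (acc rec) k<∣A∣ with 0<∣p∣⇒Nonempty (≤-<-trans z≤n k<∣A∣)
    ... | x , x∈A = ≤-trans (spanning⊎circuitHyperplane⇒spanning-∪⁅x⁆ A-x-spanning⊎CH (x∉p-x A x))
                            (rank-mono _ _ (x∈p⇒p-x∪⁅x⁆⊆p x∈A))
      where
      k≤∣A-x∣ : k ≤ ∣ A - x ∣
      k≤∣A-x∣ = ≤-pred (subst (k <_) (x∈p⇒∣p∣≡1+∣p-x∣ x∈A) k<∣A∣)
      A-x-spanning⊎CH : k ≤ r (A - x) ⊎ CircuitHyperplane r k (A - x)
      A-x-spanning⊎CH with m≤n⇒m<n∨m≡n k≤∣A-x∣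
      ... | inj₁ k<∣A-x∣ = inj₁ (go (rec (x∈p⇒p-x⊂p x∈A)) k<∣A-x∣)
      ... | inj₂ k≡∣A-x∣ = ∣A∣≡k⇒spanning⊎circuitHyperplane (sym k≡∣A-x∣)

module AKExtension {n k} {r : Subset n → ℕ} (sparse-paving : IsSparsePaving r k)
  {X Y : Subset n} (X-flat : Flat r X) (X∩Y≡⊥ : X ∩ Y ≡ ⊥) (rX+rY≡1+k : r X + r Y ≡ suc k)
  (X-not-CH : ¬ CircuitHyperplane r k X) where

  open SparsePaving sparse-paving
  open IsMatroid M
  open MatroidProperties M

  private
    variable
      A B : Subset n

  rX<k : r X < k
  rX<k = ≰⇒> k≰rX
    where
    open ≤-Reasoning
    k≰rX : ¬ k ≤ r X
    k≰rX k≤rX = 1+n≰n (begin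
      suc k     ≡⟨ rX+rY≡1+k ⟨
      r X + r Y ≤⟨ +-mono-≤ (r≤k X) (rank-mono _ _ Y⊆⊥) ⟩
      k + r ⊥   ≡⟨ cong (k +_) rank-⊥ ⟩
      k + 0     ≡⟨ +-identityʳ k ⟩
      k         ∎)
      where
      X-full : ⊤ ⊆ X
      X-full = flat∧full-rank⇒⊤⊆ X-flat (≤-trans (r≤k ⊤) k≤rX)
      Y⊆⊥ : Y ⊆ ⊥
      Y⊆⊥ = subst (Y ⊆_) X∩Y≡⊥ (∩-glb (⊆-trans ⊆⊤ X-full) ⊆-refl)

  ∣X∣<k : ∣ X ∣ < k
  ∣X∣<k with <-cmp ∣ X ∣ k
  ... | tri< ∣X∣<k _ _ = ∣X∣<k
  ... | tri≈ _ ∣X∣≡k _ = ⊥-elim ([ <⇒≱ rX<k , X-not-CH ]′ (∣A∣≡k⇒spanning⊎circuitHyperplane ∣X∣≡k))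
  ... | tri> _ _ k<∣X∣ = contradiction (k<∣A∣⇒spanning k<∣X∣) (<⇒≱ rX<k)

  ⊆X⇒independent : A ⊆ X → r A ≡ ∣ A ∣
  ⊆X⇒independent A⊆X = ∣A∣<k⇒independent (≤-<-trans (p⊆q⇒∣p∣≤∣q∣ A⊆X) ∣X∣<k)

  ⊆X⇒modular : A ⊆ X → B ⊆ X → r A + r B ≡ r (A ∪ B) + r (A ∩ B)
  ⊆X⇒modular {A} {B} A⊆X B⊆X = begin
    r A + r B             ≡⟨ cong₂ _+_ (⊆X⇒independent A⊆X) (⊆X⇒independent B⊆X) ⟩
    ∣ A ∣ + ∣ B ∣         ≡⟨ ∣p∪q∣+∣p∩q∣≡∣p∣+∣q∣ A B ⟨
    ∣ A ∪ B ∣ + ∣ A ∩ B ∣ ≡⟨ cong₂ _+_ (⊆X⇒independent (∪-lub A⊆X B⊆X))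
                                      (⊆X⇒independent (⊆-trans (p∩q⊆p A B) A⊆X)) ⟨
    r (A ∪ B) + r (A ∩ B) ∎
    where open ≡-Reasoning

  rX+rY≡1+r[X∪Y] : r X + r Y ≡ suc (r (X ∪ Y))
  rX+rY≡1+r[X∪Y] = trans rX+rY≡1+k (cong suc (sym r[X∪Y]≡k))
    where
    open ≤-Reasoning
    r[X∪Y]≡k : r (X ∪ Y) ≡ k
    r[X∪Y]≡k = ≤-antisym (r≤k _) (k<∣A∣⇒spanning (begin-strict
      k                     <⟨ n<1+n k ⟩
      suc k                 ≡⟨ rX+rY≡1+k ⟨
      r X + r Y             ≤⟨ +-mono-≤ (rank-bounded X) (rank-bounded Y) ⟩
      ∣ X ∣ + ∣ Y ∣         ≡⟨ ∣p∪q∣+∣p∩q∣≡∣p∣+∣q∣ X Y ⟨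
      ∣ X ∪ Y ∣ + ∣ X ∩ Y ∣ ≡⟨ cong (λ Z → ∣ X ∪ Y ∣ + ∣ Z ∣) X∩Y≡⊥ ⟩
      ∣ X ∪ Y ∣ + ∣ ⊥ {n} ∣ ≡⟨ cong (∣ X ∪ Y ∣ +_) (∣⊥∣≡0 n) ⟩
      ∣ X ∪ Y ∣ + 0         ≡⟨ +-identityʳ _ ⟩
      ∣ X ∪ Y ∣             ∎))

  mutual≤1 : A ⊆ X → r A + r Y ≤ suc (r (A ∪ Y))
  mutual≤1 {A} A⊆X = +-cancelʳ-≤ (r (X ∪ Y)) _ _ (begin
    r A + r Y + r (X ∪ Y)       ≡⟨ xy∙z≈xz∙y (r A) (r Y) (r (X ∪ Y)) ⟩
    r A + r (X ∪ Y) + r Y       ≤⟨ +-monoˡ-≤ (r Y) (mutual-mono Y A⊆X) ⟩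
    r X + r (A ∪ Y) + r Y       ≡⟨ xy∙z≈xz∙y (r X) (r (A ∪ Y)) (r Y) ⟩
    r X + r Y + r (A ∪ Y)       ≡⟨ cong (_+ r (A ∪ Y)) rX+rY≡1+r[X∪Y] ⟩
    suc (r (X ∪ Y)) + r (A ∪ Y) ≡⟨ cong suc (+-comm (r (X ∪ Y)) (r (A ∪ Y))) ⟩
    suc (r (A ∪ Y)) + r (X ∪ Y) ∎)
    where open ≤-Reasoning

  X-nonskew : Nonskew Y X
  X-nonskew = ≤-reflexive (sym rX+rY≡1+r[X∪Y])

  -- Closure under intersection makes an inclusion-minimal such set the least one.
  private
    minimal : ∃ λ F → (F ⊆ X × Nonskew Y F) × (∀ {B} → B ⊂ F → ¬ (B ⊆ X × Nonskew Y B))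
    minimal = ⊂-minimal (λ A → A ⊆? X ×-dec nonskew? Y A) (⊆-refl , X-nonskew)

  F : Subset n
  F = proj₁ minimal

  F⊆X : F ⊆ X
  F⊆X = proj₁ (proj₁ (proj₂ minimal))

  F-nonskew : Nonskew Y F
  F-nonskew = proj₂ (proj₁ (proj₂ minimal))

  F-least : A ⊆ X → Nonskew Y A → F ⊆ A
  F-least {A} A⊆X A-nonskew = ⊆-trans (p⊆q∧p⊄q⇒q⊆p (p∩q⊆q A F) A∩F⊄F) (p∩q⊆p A F)
    where
    A∩F⊄F : A ∩ F ⊄ F
    A∩F⊄F A∩F⊂F = proj₂ (proj₂ minimal) A∩F⊂F
      ( ⊆-trans (p∩q⊆p A F) A⊆X
      , nonskew-∩ Y (⊆X⇒modular A⊆X F⊆X) (mutual≤1 (∪-lub A⊆X F⊆X)) A-nonskew F-nonskew)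

  skew⇒rank-grows-by-F : A ⊆ X → ¬ Nonskew Y A → r A < r (A ∪ F)
  skew⇒rank-grows-by-F {A} A⊆X A-skew with A ⊂? A ∪ F
  ... | yes A⊂A∪F = begin-strict
    r A       ≡⟨ ⊆X⇒independent A⊆X ⟩
    ∣ A ∣     <⟨ p⊂q⇒∣p∣<∣q∣ A⊂A∪F ⟩
    ∣ A ∪ F ∣ ≡⟨ ⊆X⇒independent (∪-lub A⊆X F⊆X) ⟨
    r (A ∪ F) ∎
    where open ≤-Reasoning
  ... | no A⊄A∪F = contradiction (nonskew-mono Y F⊆A F-nonskew) A-skew
    where
    F⊆A : F ⊆ A
    F⊆A = ⊆-trans (q⊆p∪q A F) (p⊆q∧p⊄q⇒q⊆p (p⊆p∪q F) A⊄A∪F)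

  open PrincipalExtension M F

  rank⁺-⊤+rY≡r[A∪Y]+1 : A ⊆ X → rank⁺ A ⊤ + r Y ≡ r (A ∪ Y) + 1
  rank⁺-⊤+rY≡r[A∪Y]+1 {A} A⊆X = trans (rank⁺-⊤+rY≡1+r[A∪Y] (nonskew? Y A)) (+-comm 1 _)
    where
    open ≡-Reasoning
    rank⁺-⊤+rY≡1+r[A∪Y] : Dec (Nonskew Y A) → rank⁺ A ⊤ + r Y ≡ suc (r (A ∪ Y))
    rank⁺-⊤+rY≡1+r[A∪Y] (yes A-nonskew) = begin
      rank⁺ A ⊤ + r Y ≡⟨ cong (_+ r Y) (rank⁺-⊤-spanned (F-least A⊆X A-nonskew)) ⟩
      r A + r Y       ≡⟨ ≤-antisym (mutual≤1 A⊆X) A-nonskew ⟩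
      suc (r (A ∪ Y)) ∎
    rank⁺-⊤+rY≡1+r[A∪Y] (no A-skew) = begin
      rank⁺ A ⊤ + r Y ≡⟨ cong (_+ r Y) (rank⁺-⊤-free (skew⇒rank-grows-by-F A⊆X A-skew)) ⟩
      suc (r A + r Y) ≡⟨ cong suc (≤-antisym (≮⇒≥ A-skew) (rank-subadditive A Y)) ⟩
      suc (r (A ∪ Y)) ∎

  g : Subset (n + 1) → ℚ
  g U = toℚ (rank U)

  cond-++ : ∀ A B a b → cond g (A ++ a) (B ++ b) ≡ toℚ (rank⁺ (A ∪ B) (a ∪ b)) ℚ.- toℚ (rank⁺ B b)
  cond-++ A B a b = cong₂ (λ u v → toℚ u ℚ.- toℚ v) (rank-++-∪ A B a b) (rank-++ B b)

  AK1 : cond g (Zset n 1) (liftQ 1 X) ≡ ℚ.0ℚ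
  AK1 = begin
    cond g (Zset n 1) (liftQ 1 X)       ≡⟨ cond-++ ⊥ X ⊤ ⊥ ⟩
    toℚ (rank⁺ (⊥ ∪ X) ⊤) ℚ.- toℚ (r X) ≡⟨ cong (λ m → toℚ m ℚ.- toℚ (r X)) rank⁺-⊤-X ⟩
    toℚ (r X) ℚ.- toℚ (r X)             ≡⟨ ℚᵖ.+-inverseʳ (toℚ (r X)) ⟩
    ℚ.0ℚ                                ∎
    where
    open ≡-Reasoning
    rank⁺-⊤-X : rank⁺ (⊥ ∪ X) ⊤ ≡ r X
    rank⁺-⊤-X = trans (cong (λ B → rank⁺ B ⊤) (∪-identityˡ X)) (rank⁺-⊤-spanned F⊆X)

  AK2 : ∀ X′ → X′ ⊆ X → cond g (liftQ 1 X′) (Zset n 1) ≡ cond g (liftQ 1 X′) (liftQ 1 Y)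
  AK2 X′ X′⊆X = begin
    cond g (liftQ 1 X′) (Zset n 1)                ≡⟨ cond-++ X′ ⊥ ⊥ ⊤ ⟩
    toℚ (rank⁺ (X′ ∪ ⊥) ⊤) ℚ.- toℚ (rank⁺ ⊥ ⊤)    ≡⟨ cong₂ (λ B m → toℚ (rank⁺ B ⊤) ℚ.- toℚ m)
                                                          (∪-identityʳ X′) (rank⁺-⊥-⊤ 0<rF) ⟩
    toℚ (rank⁺ X′ ⊤) ℚ.- toℚ 1                    ≡⟨ cross-sum⇒toℚ-diff≡ _ 1 (r (X′ ∪ Y)) (r Y)
                                                          (rank⁺-⊤+rY≡r[A∪Y]+1 X′⊆X) ⟩
    toℚ (r (X′ ∪ Y)) ℚ.- toℚ (r Y)                ≡⟨ cond-++ X′ Y ⊥ ⊥ ⟨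
    cond g (liftQ 1 X′) (liftQ 1 Y)               ∎
    where
    open ≡-Reasoning
    0<rF : 0 < r F
    0<rF = nonskew⇒rank-pos Y F-nonskew

  isAKExtension : IsAKExtension r X Y 1 g
  isAKExtension = (matroid⇒polymatroid isMatroid , λ A → cong toℚ (rank-++ A ⊥))
                , AK1
                , AK2

proposition5p7 : (n k : ℕ) (r : Subset n → ℕ) → IsSparsePaving r k
    → (X Y : Subset n) → Flat r X → Flat r Y → X ∩ Y ≡ ⊥ → Nonmodular r X Y
    → r X + r Y ≡ suc k → ¬ CircuitHyperplane r k X
    → ∃₂ λ (m : ℕ) (g : Subset (n + m) → ℚ) → IsAKExtension r X Y m g
proposition5p7 n k r sparse-paving X Y X-flat _ X∩Y≡⊥ _ rX+rY≡1+k X-not-CH =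
  1 , g , isAKExtension
  where open AKExtension sparse-paving X-flat X∩Y≡⊥ rX+rY≡1+k X-not-CH
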